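{- $\kappa(P_4,5)=10$, where $P_4$ is the graph with vertex set $\{1,2,3,4\}$ and edge set $\{\{1,2\},\{2,3\},\{3,4\}\}$.
   Context: Permutations of $[m]=\{1,\dots,m\}$ are written as sequences $(\pi(1),\dots,\pi(m))$. For a simple graph $G$ with $V(G)\subseteq\mathbb{N}$, two permutations $\pi,\sigma$ of $[m]$ are $G$-different if $\{\pi(i),\sigma(i)\}\in E(G)$ for some position $i$, and $\kappa(G,m)$ is the maximum number of pairwise $G$-different permutations of $[m]$. -}

module Defs where

open import Data.Nat using (ℕ; suc; _≤_)
open import Data.Fin using (Fin; toℕ)
open import Data.Fin.Permutation using (Permutation′; _⟨$⟩ʳ_)
open import Data.Product using (Σ; ∃; _×_)
open import Relation.Nullary using (¬_)
open import Relation.Binary.PropositionalEquality using (_≡_)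

record SimpleGraph : Set₁ where
  field
    Adj       : ℕ → ℕ → Set
    Adj-sym   : ∀ {u v} → Adj u v → Adj v u
    Adj-irref : ∀ {u} → ¬ Adj u u
open SimpleGraph public

-- Permutations of [m] = {1,…,m}; π(i) is the value (toℕ (π ⟨$⟩ʳ i)) + 1
-- at position i (positions Fin m ↔ {1,…,m}).
Perm : ℕ → Set
Perm m = Permutation′ m

val : ∀ {m} → Perm m → Fin m → ℕ
val π i = suc (toℕ (π ⟨$⟩ʳ i))

GDifferent : (G : SimpleGraph) {m : ℕ} → Perm m → Perm m → Set
GDifferent G π σ = ∃ λ i → Adj G (val π i) (val σ i)

PairwiseGDifferent : (G : SimpleGraph) (m k : ℕ) → (Fin k → Perm m) → Set
PairwiseGDifferent G m k f = ∀ a b → ¬ a ≡ b → GDifferent G (f a) (f b)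

κ≡ : SimpleGraph → ℕ → ℕ → Set
κ≡ G m k =
  (Σ (Fin k → Perm m) (PairwiseGDifferent G m k)) ×
  (∀ k′ (f : Fin k′ → Perm m) → PairwiseGDifferent G m k′ f → k′ ≤ k)

data P4Adj : ℕ → ℕ → Set where
  e12 : P4Adj 1 2
  e21 : P4Adj 2 1
  e23 : P4Adj 2 3
  e32 : P4Adj 3 2
  e34 : P4Adj 3 4
  e43 : P4Adj 4 3

P4-sym : ∀ {u v} → P4Adj u v → P4Adj v u
P4-sym e12 = e21
P4-sym e21 = e12
P4-sym e23 = e32
P4-sym e32 = e23
P4-sym e34 = e43
P4-sym e43 = e34

P4-irref : ∀ {u} → ¬ P4Adj u u
P4-irref ()

P4 : SimpleGraph
P4 = record { Adj = P4Adj ; Adj-sym = P4-sym ; Adj-irref = P4-irref }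

-- P₄ is properly coloured by parity, so two permutations of [5] can only be
-- P₄-different if the pairs of positions holding the even values 2 and 4
-- differ. There are only C(5,2) = 10 such pairs, and ten permutations
-- realising them are pairwise P₄-different, as a finite computation confirms.
module Submission where

open import Defs
open import Data.Bool using (Bool; _∨_; if_then_else_)
open import Data.Bool.Properties using (∨-comm)
open import Data.Empty using (⊥-elim)
open import Data.Fin using (Fin; zero; suc; toℕ; #_; _↑ˡ_; _↑ʳ_; splitAt)
open import Data.Fin.Permutation using (_⟨$⟩ʳ_; _⟨$⟩ˡ_; permutation; inverseˡ; inverseʳ)
open import Data.Fin.Properties
  using (_≟_; any?; all?; injective⇒≤; ↑ˡ-injective; ↑ʳ-injective; splitAt-↑ˡ; splitAt-↑ʳ)
open import Data.Nat as ℕ using (ℕ; _+_; _≤_; parity)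
open import Data.Parity using (Parity; 0ℙ; 1ℙ)
open import Data.Product using (_×_; _,_)
open import Data.Sum using (_⊎_; inj₁; inj₂)
open import Data.Vec using (Vec; []; _∷_; lookup)
open import Function using (_∘_)
open import Function.Bundles using (mk⇔)
open import Relation.Binary.PropositionalEquality
  using (_≡_; _≢_; refl; sym; trans; cong; cong₂; module ≡-Reasoning)
open import Relation.Nullary using (¬_; Dec; does; yes; no)
open import Relation.Nullary.Decidable
  using (True; toWitness; map′; does-⇔; _⊎-dec_; _→-dec_; ¬?)

module _ (G : SimpleGraph) (Adj? : ∀ u v → Dec (Adj G u v)) where

  GDifferent? : ∀ {m} (π σ : Perm m) → Dec (GDifferent G π σ)
  GDifferent? π σ = any? (λ i → Adj? (val π i) (val σ i))

  PairwiseGDifferent? : ∀ m k (f : Fin k → Perm m) → Dec (PairwiseGDifferent G m k f)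
  PairwiseGDifferent? m k f =
    all? λ a → all? λ b → ¬? (a ≟ b) →-dec GDifferent? (f a) (f b)

preimage : ∀ {n} → (Fin n → Fin n) → Fin n → Fin n
preimage f y with any? (λ x → f x ≟ y)
... | yes (x , _) = x
... | no _        = y   -- junk; excluded by the checks in fromOneLine

fromOneLine : ∀ {n} (v : Vec (Fin n) n) →
              {True (all? λ y → lookup v (preimage (lookup v) y) ≟ y)} →
              {True (all? λ x → preimage (lookup v) (lookup v x) ≟ x)} →
              Perm n
fromOneLine v {inverse₁} {inverse₂} =
  permutation (lookup v) (preimage (lookup v)) (toWitness inverse₁) (toWitness inverse₂)

module _ {G : SimpleGraph} {m k : ℕ} (key : Perm m → Fin k)
         (key-fibre : ∀ π σ → key π ≡ key σ → ¬ GDifferent G π σ) where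

  pairwiseGDifferent⇒≤ : ∀ k′ (f : Fin k′ → Perm m) → PairwiseGDifferent G m k′ f → k′ ≤ k
  pairwiseGDifferent⇒≤ k′ f different = injective⇒≤ key∘f-injective
    where
    key∘f-injective : ∀ {a b} → key (f a) ≡ key (f b) → a ≡ b
    key∘f-injective {a} {b} eq with a ≟ b
    ... | yes a≡b = a≡b
    ... | no a≢b  = ⊥-elim (key-fibre (f a) (f b) eq (different a b a≢b))

IsProperColouring : ∀ {C : Set} → SimpleGraph → (ℕ → C) → Set
IsProperColouring G c = ∀ {u v} → Adj G u v → c u ≢ c v

sameColours⇒¬GDifferent : ∀ {C : Set} {G} {c : ℕ → C} {m} {π σ : Perm m} →
                          IsProperColouring G c →
                          (∀ i → c (val π i) ≡ c (val σ i)) → ¬ GDifferent G π σ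
sameColours⇒¬GDifferent proper same (i , adj) = proper adj (same i)

-- n C 2, via (n + 1) C 2 = n + n C 2.
pairCount : ℕ → ℕ
pairCount ℕ.zero    = 0
pairCount (ℕ.suc n) = n + pairCount n

pairIndex : ∀ {n} (p q : Fin n) → p ≢ q → Fin (pairCount n)
pairIndex {ℕ.suc n} zero    zero    p≢q = ⊥-elim (p≢q refl)
pairIndex {ℕ.suc n} zero    (suc q) _   = q ↑ˡ pairCount n
pairIndex {ℕ.suc n} (suc p) zero    _   = p ↑ˡ pairCount n
pairIndex {ℕ.suc n} (suc p) (suc q) p≢q = n ↑ʳ pairIndex p q (p≢q ∘ cong suc)

SamePair : ∀ {n} (p q p′ q′ : Fin n) → Set
SamePair p q p′ q′ = (p ≡ p′ × q ≡ q′) ⊎ (p ≡ q′ × q ≡ p′)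

↑ˡ≢↑ʳ : ∀ {m n} (i : Fin m) (j : Fin n) → i ↑ˡ n ≢ m ↑ʳ j
↑ˡ≢↑ʳ {m} {n} i j eq
  with trans (sym (splitAt-↑ˡ m i n)) (trans (cong (splitAt m) eq) (splitAt-↑ʳ m n j))
... | ()

pairIndex-injective : ∀ {n} {p q p′ q′ : Fin n} (p≢q : p ≢ q) (p′≢q′ : p′ ≢ q′) →
                      pairIndex p q p≢q ≡ pairIndex p′ q′ p′≢q′ → SamePair p q p′ q′
pairIndex-injective {p = zero} {zero} p≢q _ _ = ⊥-elim (p≢q refl)
pairIndex-injective {p′ = zero} {zero} _ p′≢q′ _ = ⊥-elim (p′≢q′ refl)
pairIndex-injective {ℕ.suc n} {zero} {suc q} {zero} {suc q′} _ _ eq =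
  inj₁ (refl , cong suc (↑ˡ-injective (pairCount n) q q′ eq))
pairIndex-injective {ℕ.suc n} {zero} {suc q} {suc p′} {zero} _ _ eq =
  inj₂ (refl , cong suc (↑ˡ-injective (pairCount n) q p′ eq))
pairIndex-injective {ℕ.suc n} {suc p} {zero} {zero} {suc q′} _ _ eq =
  inj₂ (cong suc (↑ˡ-injective (pairCount n) p q′ eq) , refl)
pairIndex-injective {ℕ.suc n} {suc p} {zero} {suc p′} {zero} _ _ eq =
  inj₁ (cong suc (↑ˡ-injective (pairCount n) p p′ eq) , refl)
pairIndex-injective {p = zero} {suc q} {suc _} {suc _} _ _ eq = ⊥-elim (↑ˡ≢↑ʳ q _ eq)
pairIndex-injective {p = suc p} {zero} {suc _} {suc _} _ _ eq = ⊥-elim (↑ˡ≢↑ʳ p _ eq)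
pairIndex-injective {p = suc _} {suc _} {zero} {suc q′} _ _ eq = ⊥-elim (↑ˡ≢↑ʳ q′ _ (sym eq))
pairIndex-injective {p = suc _} {suc _} {suc p′} {zero} _ _ eq = ⊥-elim (↑ˡ≢↑ʳ p′ _ (sym eq))
pairIndex-injective {ℕ.suc n} {suc p} {suc q} {suc p′} {suc q′} p≢q p′≢q′ eq
  with pairIndex-injective (p≢q ∘ cong suc) (p′≢q′ ∘ cong suc) (↑ʳ-injective n _ _ eq)
... | inj₁ (refl , refl) = inj₁ (refl , refl)
... | inj₂ (refl , refl) = inj₂ (refl , refl)

isOneOf : ∀ {n} → Fin n → Fin n → Fin n → Bool
isOneOf p q i = does (i ≟ p) ∨ does (i ≟ q)

isOneOf-cong : ∀ {n} {p q p′ q′ : Fin n} → SamePair p q p′ q′ →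
               ∀ i → isOneOf p q i ≡ isOneOf p′ q′ i
isOneOf-cong (inj₁ (refl , refl)) i = refl
isOneOf-cong {p = p} {q} (inj₂ (refl , refl)) i = ∨-comm (does (i ≟ p)) (does (i ≟ q))

isOneOf-⟨$⟩ʳ : ∀ {n} (π : Perm n) a b i →
               isOneOf a b (π ⟨$⟩ʳ i) ≡ isOneOf (π ⟨$⟩ˡ a) (π ⟨$⟩ˡ b) i
isOneOf-⟨$⟩ʳ π a b i = cong₂ _∨_ (moved a) (moved b)
  where
  moved : ∀ c → does (π ⟨$⟩ʳ i ≟ c) ≡ does (i ≟ π ⟨$⟩ˡ c)
  moved c = does-⇔ (mk⇔ (λ { refl → sym (inverseˡ π) }) (λ { refl → inverseʳ π }))
                   (π ⟨$⟩ʳ i ≟ c) (i ≟ π ⟨$⟩ˡ c)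

⟨$⟩ˡ-injective : ∀ {n} (π : Perm n) {a b} → π ⟨$⟩ˡ a ≡ π ⟨$⟩ˡ b → a ≡ b
⟨$⟩ˡ-injective π eq = trans (sym (inverseʳ π)) (trans (cong (π ⟨$⟩ʳ_) eq) (inverseʳ π))

positionsOf : ∀ {n} {a b : Fin n} → a ≢ b → Perm n → Fin (pairCount n)
positionsOf {a = a} {b} a≢b π = pairIndex (π ⟨$⟩ˡ a) (π ⟨$⟩ˡ b) (a≢b ∘ ⟨$⟩ˡ-injective π)

positionsOf-≡ : ∀ {n} {a b : Fin n} (a≢b : a ≢ b) {π σ : Perm n} →
                positionsOf a≢b π ≡ positionsOf a≢b σ →
                ∀ i → isOneOf a b (π ⟨$⟩ʳ i) ≡ isOneOf a b (σ ⟨$⟩ʳ i)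
positionsOf-≡ {a = a} {b} a≢b {π} {σ} eq i = begin
  isOneOf a b (π ⟨$⟩ʳ i)           ≡⟨ isOneOf-⟨$⟩ʳ π a b i ⟩
  isOneOf (π ⟨$⟩ˡ a) (π ⟨$⟩ˡ b) i  ≡⟨ isOneOf-cong (pairIndex-injective _ _ eq) i ⟩
  isOneOf (σ ⟨$⟩ˡ a) (σ ⟨$⟩ˡ b) i  ≡⟨ isOneOf-⟨$⟩ʳ σ a b i ⟨
  isOneOf a b (σ ⟨$⟩ʳ i)           ∎
  where open ≡-Reasoning

P4Adj? : ∀ u v → Dec (P4Adj u v)
P4Adj? 0 v = no λ ()
P4Adj? 1 v = map′ (λ { refl → e12 }) (λ { e12 → refl }) (v ℕ.≟ 2)
P4Adj? 2 v = map′ (λ { (inj₁ refl) → e21 ; (inj₂ refl) → e23 })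
                  (λ { e21 → inj₁ refl ; e23 → inj₂ refl })
                  (v ℕ.≟ 1 ⊎-dec v ℕ.≟ 3)
P4Adj? 3 v = map′ (λ { (inj₁ refl) → e32 ; (inj₂ refl) → e34 })
                  (λ { e32 → inj₁ refl ; e34 → inj₂ refl })
                  (v ℕ.≟ 2 ⊎-dec v ℕ.≟ 4)
P4Adj? 4 v = map′ (λ { refl → e43 }) (λ { e43 → refl }) (v ℕ.≟ 3)
P4Adj? (ℕ.suc (ℕ.suc (ℕ.suc (ℕ.suc (ℕ.suc _))))) v = no λ ()

parity-properColouring : IsProperColouring P4 parity
parity-properColouring e12 ()
parity-properColouring e21 ()
parity-properColouring e23 ()
parity-properColouring e32 ()
parity-properColouring e34 ()
parity-properColouring e43 ()

evenIf : Bool → Parity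
evenIf b = if b then 0ℙ else 1ℙ

-- The values 2 and 4 sit at Fin-indices 1 and 3.
parity-suc-toℕ : ∀ (j : Fin 5) → parity (ℕ.suc (toℕ j)) ≡ evenIf (isOneOf (# 1) (# 3) j)
parity-suc-toℕ zero                         = refl
parity-suc-toℕ (suc zero)                   = refl
parity-suc-toℕ (suc (suc zero))             = refl
parity-suc-toℕ (suc (suc (suc zero)))       = refl
parity-suc-toℕ (suc (suc (suc (suc zero)))) = refl

1≢3 : _≢_ {A = Fin 5} (# 1) (# 3)
1≢3 ()

evenPositions : Perm 5 → Fin 10
evenPositions = positionsOf 1≢3

evenPositions-fibre : ∀ π σ → evenPositions π ≡ evenPositions σ → ¬ GDifferent P4 π σ
evenPositions-fibre π σ eq =
  sameColours⇒¬GDifferent {G = P4} {π = π} {σ} parity-properColouring λ i → begin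
    parity (val π i)                           ≡⟨ parity-suc-toℕ (π ⟨$⟩ʳ i) ⟩
    evenIf (isOneOf (# 1) (# 3) (π ⟨$⟩ʳ i))  ≡⟨ cong evenIf (positionsOf-≡ 1≢3 {π} {σ} eq i) ⟩
    evenIf (isOneOf (# 1) (# 3) (σ ⟨$⟩ʳ i))  ≡⟨ parity-suc-toℕ (σ ⟨$⟩ʳ i) ⟨
    parity (val σ i)                           ∎
  where open ≡-Reasoning

-- One-line notation shifted down by one: entry j stands for the value j + 1.
family : Fin 10 → Perm 5
family = lookup
  ( fromOneLine (# 0 ∷ # 1 ∷ # 2 ∷ # 3 ∷ # 4 ∷ [])
  ∷ fromOneLine (# 0 ∷ # 1 ∷ # 3 ∷ # 4 ∷ # 2 ∷ [])
  ∷ fromOneLine (# 1 ∷ # 3 ∷ # 2 ∷ # 4 ∷ # 0 ∷ [])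
  ∷ fromOneLine (# 1 ∷ # 4 ∷ # 3 ∷ # 2 ∷ # 0 ∷ [])
  ∷ fromOneLine (# 2 ∷ # 0 ∷ # 4 ∷ # 1 ∷ # 3 ∷ [])
  ∷ fromOneLine (# 2 ∷ # 4 ∷ # 1 ∷ # 0 ∷ # 3 ∷ [])
  ∷ fromOneLine (# 3 ∷ # 2 ∷ # 0 ∷ # 1 ∷ # 4 ∷ [])
  ∷ fromOneLine (# 3 ∷ # 2 ∷ # 4 ∷ # 0 ∷ # 1 ∷ [])
  ∷ fromOneLine (# 4 ∷ # 0 ∷ # 1 ∷ # 3 ∷ # 2 ∷ [])
  ∷ fromOneLine (# 4 ∷ # 3 ∷ # 0 ∷ # 2 ∷ # 1 ∷ [])
  ∷ [])

family-pairwiseGDifferent : PairwiseGDifferent P4 5 10 family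
family-pairwiseGDifferent = toWitness {a? = PairwiseGDifferent? P4 P4Adj? 5 10 family} _

lemma4 : κ≡ P4 5 10
lemma4 = (family , family-pairwiseGDifferent) ,
         pairwiseGDifferent⇒≤ {G = P4} evenPositions evenPositions-fibre
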